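{- Let $T$ be a commutative monad on a cartesian monoidal category $\mathbb C$ such that for every object $X$ the pair $\eta_{TX},T\eta_X:TX\rightrightarrows TTX$ has an equalizer $\theta_X:DX\to TX$. Let $R$ be an object of $\mathbb C$ such that $T$ is $R$-observational and $TR$ is injective with respect to the class of regular monomorphisms. Then the monad $D$ of thunkable morphisms is idempotent.
   Context: Kleisli morphisms $f:A\rightsquigarrow B$ correspond to $f^\sharp:A\to TB$; for $h:A\to TB$ write $h^\flat$ for the corresponding Kleisli morphism; composition $(g\circledcirc f)^\sharp=\mu\circ Tg^\sharp\circ f^\sharp$. Commutativity gives $\nabla_{A,B}:TA\times TB\to T(A\times B)$, and $\mathsf{Kl}(T)$ is monoidal with $A\otimes B=A\times B$, $(f\otimes g)^\sharp=\nabla\circ(f^\sharp\times g^\sharp)$; $(\mathsf{copy}_X)^\sharp=\eta\circ\Delta$, $(\mathsf{del}_X)^\sharp=\eta\circ!$; $\mathsf{copy}_n$ is the $n$-fold iterated copy ($\mathsf{copy}_0=\mathsf{del}$); $(\mathsf{force}_X)^\sharp=1_{TX}$; $\mathsf{samp}_n=\mathsf{force}^{\otimes n}\circledcirc\mathsf{copy}_n:TX\rightsquigarrow X^{\otimes n}$. $T$ is $R$-observational if for every object $X$ the family of Kleisli morphisms $(h_1^\flat\otimes\cdots\otimes h_n^\flat)\circledcirc\mathsf{samp}_n:TX\rightsquigarrow R^{\otimes n}$, indexed by $n\in\mathbb N$ and $h_1,\dots,h_n:X\to TR$, is jointly monic in $\mathsf{Kl}(T)$. An object $P$ is injective w.r.t.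 regular monos if for every regular mono $i:A\to B$ and $h:A\to P$ there is $k:B\to P$ with $k\circ i=h$. A Kleisli morphism $f:X\rightsquigarrow Y$ is thunkable iff $\eta_{TY}\circ f^\sharp=T\eta_Y\circ f^\sharp$; thunkable morphisms $X\rightsquigarrow Y$ correspond bijectively to morphisms $X\to DY$ via $u\mapsto\theta_Y\circ u$, and this is an adjunction between $\mathbb C$ and the wide subcategory of thunkable Kleisli morphisms; $D$ is the induced monad on $\mathbb C$ (unit $e_X$ with $\theta_X\circ e_X=\eta_X$). $D$ is idempotent if its multiplication $DD\Rightarrow D$ is an isomorphism. -}

module Defs where

open import Level using (Level; _⊔_) renaming (suc to lsuc)
open import Data.Nat using (ℕ; zero; suc)
open import Data.Fin using (Fin; zero; suc)
open import Data.Product using (Σ; _×_; _,_)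
open import Relation.Binary using (Rel; IsEquivalence)

record Category (o ℓ e : Level) : Set (lsuc (o ⊔ ℓ ⊔ e)) where
  infixr 9 _∘_
  infix 4 _≈_
  field
    Obj : Set o
    Hom : Obj → Obj → Set ℓ
    _≈_ : ∀ {A B} → Rel (Hom A B) e
    id : ∀ {A} → Hom A A
    _∘_ : ∀ {A B C} → Hom B C → Hom A B → Hom A C
    ≈-equiv : ∀ {A B} → IsEquivalence (_≈_ {A} {B})
    ∘-resp-≈ : ∀ {A B C} {f f' : Hom B C} {g g' : Hom A B} →
               f ≈ f' → g ≈ g' → f ∘ g ≈ f' ∘ g'
    identityˡ : ∀ {A B} {f : Hom A B} → id ∘ f ≈ f
    identityʳ : ∀ {A B} {f : Hom A B} → f ∘ id ≈ f
    assoc : ∀ {A B C D} {f : Hom A B} {g : Hom B C} {h : Hom C D} →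
            (h ∘ g) ∘ f ≈ h ∘ (g ∘ f)

module _ {o ℓ e : Level} (C : Category o ℓ e) where
  open Category C

  IsIso : ∀ {A B} → Hom A B → Set (ℓ ⊔ e)
  IsIso {A} {B} f = Σ (Hom B A) λ g → (g ∘ f ≈ id) × (f ∘ g ≈ id)

  record IsEqualizer {E A B : Obj} (m : Hom E A) (f g : Hom A B) : Set (o ⊔ ℓ ⊔ e) where
    field
      equality : f ∘ m ≈ g ∘ m
      factor : ∀ {Z} (h : Hom Z A) → f ∘ h ≈ g ∘ h → Hom Z E
      factor-prop : ∀ {Z} (h : Hom Z A) (eq : f ∘ h ≈ g ∘ h) → m ∘ factor h eq ≈ h
      factor-unique : ∀ {Z} (h : Hom Z A) (eq : f ∘ h ≈ g ∘ h) (u : Hom Z E) →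
                      m ∘ u ≈ h → u ≈ factor h eq

  IsRegularMono : ∀ {A B} → Hom A B → Set (o ⊔ ℓ ⊔ e)
  IsRegularMono {A} {B} i = Σ Obj λ Z → Σ (Hom B Z) λ f → Σ (Hom B Z) λ g → IsEqualizer i f g

  InjectiveRegular : Obj → Set (o ⊔ ℓ ⊔ e)
  InjectiveRegular P = ∀ {A B} (i : Hom A B) → IsRegularMono i →
                       (h : Hom A P) → Σ (Hom B P) λ k → k ∘ i ≈ h

  -- cartesian monoidal structure = chosen finite products
  record Cartesian : Set (o ⊔ ℓ ⊔ e) where
    infixr 7 _×₀_
    field
      ⊤ : Obj
      ! : ∀ {A} → Hom A ⊤
      !-unique : ∀ {A} (f : Hom A ⊤) → f ≈ !
      _×₀_ : Obj → Obj → Obj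
      π₁ : ∀ {A B} → Hom (A ×₀ B) A
      π₂ : ∀ {A B} → Hom (A ×₀ B) B
      ⟨_,_⟩ : ∀ {X A B} → Hom X A → Hom X B → Hom X (A ×₀ B)
      π₁∘⟨⟩ : ∀ {X A B} {f : Hom X A} {g : Hom X B} → π₁ ∘ ⟨ f , g ⟩ ≈ f
      π₂∘⟨⟩ : ∀ {X A B} {f : Hom X A} {g : Hom X B} → π₂ ∘ ⟨ f , g ⟩ ≈ g
      ⟨⟩-unique : ∀ {X A B} {f : Hom X A} {g : Hom X B} {h : Hom X (A ×₀ B)} →
                  π₁ ∘ h ≈ f → π₂ ∘ h ≈ g → h ≈ ⟨ f , g ⟩

    infixr 8 _⁂_
    _⁂_ : ∀ {A B A' B'} → Hom A B → Hom A' B' → Hom (A ×₀ A') (B ×₀ B')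
    f ⁂ g = ⟨ f ∘ π₁ , g ∘ π₂ ⟩

    Δ : ∀ {A} → Hom A (A ×₀ A)
    Δ = ⟨ id , id ⟩

    swap : ∀ {A B} → Hom (A ×₀ B) (B ×₀ A)
    swap = ⟨ π₂ , π₁ ⟩

    assocʳ : ∀ {A B D} → Hom ((A ×₀ B) ×₀ D) (A ×₀ (B ×₀ D))
    assocʳ = ⟨ π₁ ∘ π₁ , ⟨ π₂ ∘ π₁ , π₂ ⟩ ⟩

  record Monad : Set (o ⊔ ℓ ⊔ e) where
    field
      T₀ : Obj → Obj
      T₁ : ∀ {A B} → Hom A B → Hom (T₀ A) (T₀ B)
      T-identity : ∀ {A} → T₁ (id {A}) ≈ id
      T-homomorphism : ∀ {A B D} {f : Hom A B} {g : Hom B D} → T₁ (g ∘ f) ≈ T₁ g ∘ T₁ f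
      T-resp-≈ : ∀ {A B} {f g : Hom A B} → f ≈ g → T₁ f ≈ T₁ g
      η : ∀ A → Hom A (T₀ A)
      μ : ∀ A → Hom (T₀ (T₀ A)) (T₀ A)
      η-natural : ∀ {A B} (f : Hom A B) → η B ∘ f ≈ T₁ f ∘ η A
      μ-natural : ∀ {A B} (f : Hom A B) → μ B ∘ T₁ (T₁ f) ≈ T₁ f ∘ μ A
      μ-assoc : ∀ {A} → μ A ∘ T₁ (μ A) ≈ μ A ∘ μ (T₀ A)
      μ-identityˡ : ∀ {A} → μ A ∘ T₁ (η A) ≈ id
      μ-identityʳ : ∀ {A} → μ A ∘ η (T₀ A) ≈ id

  record CommutativeMonad (P : Cartesian) : Set (o ⊔ ℓ ⊔ e) where
    open Cartesian P
    field
      monad : Monad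
    open Monad monad
    field
      σ : ∀ A B → Hom (A ×₀ T₀ B) (T₀ (A ×₀ B))
      σ-natural : ∀ {A A' B B'} (f : Hom A A') (g : Hom B B') →
                  σ A' B' ∘ (f ⁂ T₁ g) ≈ T₁ (f ⁂ g) ∘ σ A B
      σ-unit : ∀ {B} → T₁ π₂ ∘ σ ⊤ B ≈ π₂
      σ-assoc : ∀ {A B D} →
                T₁ assocʳ ∘ σ (A ×₀ B) D ≈ σ A (B ×₀ D) ∘ (id ⁂ σ B D) ∘ assocʳ
      σ-η : ∀ {A B} → σ A B ∘ (id ⁂ η B) ≈ η (A ×₀ B)
      σ-μ : ∀ {A B} → σ A B ∘ (id ⁂ μ B) ≈ μ (A ×₀ B) ∘ T₁ (σ A B) ∘ σ A (T₀ B)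

    τ : ∀ A B → Hom (T₀ A ×₀ B) (T₀ (A ×₀ B))
    τ A B = T₁ swap ∘ σ B A ∘ swap

    field
      commutative : ∀ {A B} →
        μ (A ×₀ B) ∘ T₁ (τ A B) ∘ σ (T₀ A) B ≈ μ (A ×₀ B) ∘ T₁ (σ A B) ∘ τ A (T₀ B)

    ∇ : ∀ A B → Hom (T₀ A ×₀ T₀ B) (T₀ (A ×₀ B))
    ∇ A B = μ (A ×₀ B) ∘ T₁ (τ A B) ∘ σ (T₀ A) B

module Theory {o ℓ e : Level} (C : Category o ℓ e) (P : Cartesian C)
              (M : CommutativeMonad C P) where
  open Category C
  open Cartesian P
  open CommutativeMonad M
  open Monad monad

  -- a Kleisli morphism A ⇝ B is represented by its transpose f♯ : A → TB
  _⇝_ : Obj → Obj → Set ℓ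
  A ⇝ B = Hom A (T₀ B)

  infixr 9 _⊚_
  _⊚_ : ∀ {A B D} → B ⇝ D → A ⇝ B → A ⇝ D
  _⊚_ {D = D} g f = μ D ∘ T₁ g ∘ f

  infixr 8 _⊗_
  _⊗_ : ∀ {A B A' B'} → A ⇝ B → A' ⇝ B' → (A ×₀ A') ⇝ (B ×₀ B')
  _⊗_ {B = B} {B' = B'} f g = ∇ B B' ∘ (f ⁂ g)

  copy : ∀ {X} → X ⇝ (X ×₀ X)
  copy {X} = η (X ×₀ X) ∘ Δ

  del : ∀ {X} → X ⇝ ⊤
  del {X} = η ⊤ ∘ !

  pow : Obj → ℕ → Obj
  pow X zero = ⊤
  pow X (suc zero) = X
  pow X (suc (suc n)) = X ×₀ pow X (suc n)

  tensorN : ∀ {A B} (n : ℕ) → (Fin n → A ⇝ B) → pow A n ⇝ pow B n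
  tensorN zero h = η ⊤
  tensorN (suc zero) h = h zero
  tensorN (suc (suc n)) h = h zero ⊗ tensorN (suc n) (λ i → h (suc i))

  copyN : ∀ X (n : ℕ) → X ⇝ pow X n
  copyN X zero = del
  copyN X (suc zero) = η X
  copyN X (suc (suc n)) = (η X ⊗ copyN X (suc n)) ⊚ copy

  force : ∀ X → T₀ X ⇝ X
  force X = id

  samp : ∀ X (n : ℕ) → T₀ X ⇝ pow X n
  samp X n = tensorN n (λ _ → force X) ⊚ copyN (T₀ X) n

  -- T is R-observational: for every X the family
  -- (h₁♭ ⊗ ⋯ ⊗ hₙ♭) ⊚ samp_n, n ∈ ℕ, hᵢ : X → TR, is jointly monic in Kl(T)
  Observational : Obj → Set (o ⊔ ℓ ⊔ e)
  Observational R =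
    ∀ X {Y} (a b : Y ⇝ T₀ X) →
    (∀ (n : ℕ) (h : Fin n → Hom X (T₀ R)) →
       (tensorN n h ⊚ samp X n) ⊚ a ≈ (tensorN n h ⊚ samp X n) ⊚ b) →
    a ≈ b

  record ThunkEqualizers : Set (o ⊔ ℓ ⊔ e) where
    field
      D₀ : Obj → Obj
      θ : ∀ X → Hom (D₀ X) (T₀ X)
      θ-equalizer : ∀ X → IsEqualizer C (θ X) (η (T₀ X)) (T₁ (η X))

  -- The monad D of thunkable morphisms is idempotent: its multiplication
  -- m_X : DDX → DX (= D applied to the counit ε_X : DX ⇝ X, ε_X♯ = θ_X,
  -- i.e. the unique map with θ_X ∘ m_X = μ_X ∘ Tθ_X ∘ θ_{DX}) is an isomorphism.
  DIdempotent : ThunkEqualizers → Set (o ⊔ ℓ ⊔ e)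
  DIdempotent E = ∀ X →
    Σ (Hom (D₀ (D₀ X)) (D₀ X)) λ m →
      (θ X ∘ m ≈ μ X ∘ T₁ (θ X) ∘ θ (D₀ X)) × IsIso C m
    where open ThunkEqualizers E

{-# OPTIONS --safe #-}
module Submission where

-- The multiplication m_X : DDX → DX is the factorisation of μ ∘ Tθ_X ∘ θ_DX through θ_X, and
-- m_X ∘ e_DX = id always. Since μ ∘ Tθ_X ∘ θ_DX is thunkable, Tθ_X ∘ θ_DX = Tθ_X ∘ η ∘ m_X, so
-- e_DX ∘ m_X = id as soon as Tθ_X can be cancelled on the left. It can: the observations
-- (h₁ ⊗ ⋯ ⊗ hₙ) ⊚ samp_n are natural in pure maps, and as TR is injective every test
-- h : DX → TR extends along the regular mono θ_X to TX, so observationality separates any two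
-- maps that Tθ_X identifies.

open import Defs
open import Level using (Level)
open import Data.Nat using (zero; suc)
open import Data.Fin using (Fin; zero; suc)
open import Data.Product using (_,_; proj₁; proj₂)
open import Relation.Binary using (Setoid; IsEquivalence)
import Relation.Binary.Reasoning.Setoid as SetoidReasoning

module HomReasoning {o ℓ e : Level} (C : Category o ℓ e) where
  open Category C

  module Equiv {A B : Obj} = IsEquivalence (≈-equiv {A} {B})
  open Equiv public using (refl; sym; trans)

  hom-setoid : Obj → Obj → Setoid ℓ e
  hom-setoid A B = record { Carrier = Hom A B ; _≈_ = _≈_ ; isEquivalence = ≈-equiv }

  module _ {A B : Obj} where
    open SetoidReasoning (hom-setoid A B) public

  infixr 4 refl⟩∘⟨_
  infixl 5 _⟩∘⟨refl

  refl⟩∘⟨_ : ∀ {A B D} {f : Hom B D} {g g' : Hom A B} → g ≈ g' → f ∘ g ≈ f ∘ g'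
  refl⟩∘⟨ p = ∘-resp-≈ refl p

  _⟩∘⟨refl : ∀ {A B D} {f f' : Hom B D} {g : Hom A B} → f ≈ f' → f ∘ g ≈ f' ∘ g
  p ⟩∘⟨refl = ∘-resp-≈ p refl

  sym-assoc : ∀ {A B D W} {f : Hom A B} {g : Hom B D} {h : Hom D W} → h ∘ (g ∘ f) ≈ (h ∘ g) ∘ f
  sym-assoc = sym assoc

  assoc² : ∀ {A B D W V} {f : Hom A B} {g : Hom B D} {h : Hom D W} {k : Hom W V} →
           (k ∘ h ∘ g) ∘ f ≈ k ∘ h ∘ g ∘ f
  assoc² = trans assoc (refl⟩∘⟨ assoc)

  module _ {A B D W : Obj} {a : Hom D W} {b : Hom B D} {c : Hom B W} (ab≈c : a ∘ b ≈ c) where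
    pullˡ : {f : Hom A B} → a ∘ (b ∘ f) ≈ c ∘ f
    pullˡ = trans sym-assoc (ab≈c ⟩∘⟨refl)

  module _ {A B D W : Obj} {a : Hom B D} {b : Hom A B} {c : Hom A D} (ab≈c : a ∘ b ≈ c) where
    pullʳ : {f : Hom D W} → (f ∘ a) ∘ b ≈ f ∘ c
    pullʳ = trans assoc (refl⟩∘⟨ ab≈c)

  id-comm-sym : ∀ {A B} {f : Hom A B} → id ∘ f ≈ f ∘ id
  id-comm-sym = trans identityˡ (sym identityʳ)

  cancelˡ : ∀ {A B D} {a : Hom B D} {b : Hom D B} {f : Hom A D} → a ∘ b ≈ id → a ∘ (b ∘ f) ≈ f
  cancelˡ ab≈id = trans (pullˡ ab≈id) identityˡ

  extendʳ : ∀ {A B D D' W} {a : Hom D W} {b : Hom B D} {c : Hom D' W} {d : Hom B D'} {f : Hom A B} →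
            a ∘ b ≈ c ∘ d → a ∘ (b ∘ f) ≈ c ∘ (d ∘ f)
  extendʳ ab≈cd = trans (pullˡ ab≈cd) assoc

module _ {o ℓ e : Level} {C : Category o ℓ e} where
  open Category C
  open HomReasoning C

  equalizer-monic : ∀ {E A B Z} {m : Hom E A} {f g : Hom A B} {u v : Hom Z E} →
                    IsEqualizer C m f g → m ∘ u ≈ m ∘ v → u ≈ v
  equalizer-monic {m = m} {f} {g} {u} {v} eq mu≈mv =
    trans (factor-unique (m ∘ v) fmv≈gmv u mu≈mv) (sym (factor-unique (m ∘ v) fmv≈gmv v refl))
    where
    open IsEqualizer eq
    fmv≈gmv : f ∘ (m ∘ v) ≈ g ∘ (m ∘ v)
    fmv≈gmv = trans sym-assoc (trans (equality ⟩∘⟨refl) assoc)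

  equalizer-regular : ∀ {E A B} {m : Hom E A} {f g : Hom A B} → IsEqualizer C m f g → IsRegularMono C m
  equalizer-regular {B = B} {f = f} {g} eq = B , f , g , eq

module ProductProperties {o ℓ e : Level} (C : Category o ℓ e) (P : Cartesian C) where
  open Category C
  open HomReasoning C
  open Cartesian P

  ⟨⟩-cong : ∀ {X A B} {f f' : Hom X A} {g g' : Hom X B} → f ≈ f' → g ≈ g' → ⟨ f , g ⟩ ≈ ⟨ f' , g' ⟩
  ⟨⟩-cong p q = ⟨⟩-unique (trans π₁∘⟨⟩ p) (trans π₂∘⟨⟩ q)

  ⟨⟩∘ : ∀ {Y X A B} {f : Hom X A} {g : Hom X B} {h : Hom Y X} → ⟨ f , g ⟩ ∘ h ≈ ⟨ f ∘ h , g ∘ h ⟩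
  ⟨⟩∘ = ⟨⟩-unique (pullˡ π₁∘⟨⟩) (pullˡ π₂∘⟨⟩)

  ⁂∘⟨⟩ : ∀ {X A B A' B'} {f : Hom A A'} {g : Hom B B'} {a : Hom X A} {b : Hom X B} →
         (f ⁂ g) ∘ ⟨ a , b ⟩ ≈ ⟨ f ∘ a , g ∘ b ⟩
  ⁂∘⟨⟩ = trans ⟨⟩∘ (⟨⟩-cong (pullʳ π₁∘⟨⟩) (pullʳ π₂∘⟨⟩))

  ⁂∘⁂ : ∀ {A B A' B' A'' B''} {f : Hom A' A''} {g : Hom B' B''} {a : Hom A A'} {b : Hom B B'} →
        (f ⁂ g) ∘ (a ⁂ b) ≈ (f ∘ a) ⁂ (g ∘ b)
  ⁂∘⁂ = trans ⁂∘⟨⟩ (⟨⟩-cong sym-assoc sym-assoc)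

  ⁂-cong : ∀ {A B A' B'} {f f' : Hom A B} {g g' : Hom A' B'} → f ≈ f' → g ≈ g' → f ⁂ g ≈ f' ⁂ g'
  ⁂-cong p q = ⟨⟩-cong (p ⟩∘⟨refl) (q ⟩∘⟨refl)

  swap∘⁂ : ∀ {A B A' B'} {f : Hom A B} {g : Hom A' B'} → swap ∘ (f ⁂ g) ≈ (g ⁂ f) ∘ swap
  swap∘⁂ = trans ⟨⟩∘ (trans (⟨⟩-cong π₂∘⟨⟩ π₁∘⟨⟩) (sym ⁂∘⟨⟩))

  swap∘swap : ∀ {A B} → swap ∘ swap ≈ id {A ×₀ B}
  swap∘swap = trans ⟨⟩∘ (trans (⟨⟩-cong π₂∘⟨⟩ π₁∘⟨⟩) (sym (⟨⟩-unique identityʳ identityʳ)))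

module MonadProperties {o ℓ e : Level} (C : Category o ℓ e) (M : Monad C) where
  open Category C
  open HomReasoning C
  open Monad M

  Thunkable : ∀ {A B} → Hom A (T₀ B) → Set e
  Thunkable {B = B} f = η (T₀ B) ∘ f ≈ T₁ (η B) ∘ f

  T₁-square : ∀ {A B B' D} {a : Hom B D} {b : Hom A B} {c : Hom B' D} {d : Hom A B'} →
              a ∘ b ≈ c ∘ d → T₁ a ∘ T₁ b ≈ T₁ c ∘ T₁ d
  T₁-square ab≈cd = trans (sym T-homomorphism) (trans (T-resp-≈ ab≈cd) T-homomorphism)

  kleisli-identityʳ : ∀ {A B} {f : Hom A (T₀ B)} → μ B ∘ T₁ f ∘ η A ≈ f
  kleisli-identityʳ {f = f} = trans (refl⟩∘⟨ sym (η-natural f)) (cancelˡ μ-identityʳ)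

  kleisli-pure : ∀ {Y A B} {f : Hom A (T₀ B)} {x : Hom Y A} → μ B ∘ T₁ f ∘ η A ∘ x ≈ f ∘ x
  kleisli-pure = trans (refl⟩∘⟨ sym-assoc) (pullˡ kleisli-identityʳ)

  η∘kleisli : ∀ {Z A B} {f : Hom A (T₀ B)} {g : Hom Z (T₀ A)} →
              Thunkable g → η (T₀ B) ∘ μ B ∘ T₁ f ∘ g ≈ T₁ f ∘ g
  η∘kleisli {A = A} {B} {f} {g} g-thunkable = begin
    η (T₀ B) ∘ μ B ∘ T₁ f ∘ g          ≈⟨ refl⟩∘⟨ sym-assoc ⟩
    η (T₀ B) ∘ (μ B ∘ T₁ f) ∘ g        ≈⟨ extendʳ (η-natural (μ B ∘ T₁ f)) ⟩
    T₁ (μ B ∘ T₁ f) ∘ η (T₀ A) ∘ g     ≈⟨ refl⟩∘⟨ g-thunkable ⟩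
    T₁ (μ B ∘ T₁ f) ∘ T₁ (η A) ∘ g     ≈⟨ pullˡ (sym T-homomorphism) ⟩
    T₁ ((μ B ∘ T₁ f) ∘ η A) ∘ g        ≈⟨ T-resp-≈ (trans assoc kleisli-identityʳ) ⟩∘⟨refl ⟩
    T₁ f ∘ g                           ∎

  Tη∘kleisli : ∀ {Z A B} {f : Hom A (T₀ B)} {g : Hom Z (T₀ A)} →
               Thunkable f → T₁ (η B) ∘ μ B ∘ T₁ f ∘ g ≈ T₁ f ∘ g
  Tη∘kleisli {B = B} {f} {g} f-thunkable = begin
    T₁ (η B) ∘ μ B ∘ T₁ f ∘ g            ≈⟨ extendʳ (sym (μ-natural (η B))) ⟩
    μ (T₀ B) ∘ T₁ (T₁ (η B)) ∘ T₁ f ∘ g  ≈⟨ refl⟩∘⟨ extendʳ (T₁-square (sym f-thunkable)) ⟩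
    μ (T₀ B) ∘ T₁ (η (T₀ B)) ∘ T₁ f ∘ g  ≈⟨ cancelˡ μ-identityˡ ⟩
    T₁ f ∘ g                             ∎

  thunkable-kleisli : ∀ {Z A B} {f : Hom A (T₀ B)} {g : Hom Z (T₀ A)} →
                      Thunkable f → Thunkable g → Thunkable (μ B ∘ T₁ f ∘ g)
  thunkable-kleisli f-thunkable g-thunkable =
    trans (η∘kleisli g-thunkable) (sym (Tη∘kleisli f-thunkable))

module CommutativeMonadProperties {o ℓ e : Level} (C : Category o ℓ e) (P : Cartesian C)
                                  (M : CommutativeMonad C P) where
  open Category C
  open HomReasoning C
  open Cartesian P
  open ProductProperties C P
  open CommutativeMonad M
  open Monad monad
  open MonadProperties C monad

  τ-natural : ∀ {A A' B B'} {f : Hom A A'} {g : Hom B B'} →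
              τ A' B' ∘ (T₁ f ⁂ g) ≈ T₁ (f ⁂ g) ∘ τ A B
  τ-natural {A} {A'} {B} {B'} {f} {g} = begin
    (T₁ swap ∘ σ B' A' ∘ swap) ∘ (T₁ f ⁂ g)  ≈⟨ assoc² ⟩
    T₁ swap ∘ σ B' A' ∘ swap ∘ (T₁ f ⁂ g)    ≈⟨ refl⟩∘⟨ refl⟩∘⟨ swap∘⁂ ⟩
    T₁ swap ∘ σ B' A' ∘ (g ⁂ T₁ f) ∘ swap    ≈⟨ refl⟩∘⟨ extendʳ (σ-natural g f) ⟩
    T₁ swap ∘ T₁ (g ⁂ f) ∘ σ B A ∘ swap      ≈⟨ extendʳ (T₁-square swap∘⁂) ⟩
    T₁ (f ⁂ g) ∘ T₁ swap ∘ σ B A ∘ swap      ∎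

  ∇-natural : ∀ {A A' B B'} {f : Hom A A'} {g : Hom B B'} →
              ∇ A' B' ∘ (T₁ f ⁂ T₁ g) ≈ T₁ (f ⁂ g) ∘ ∇ A B
  ∇-natural {A} {A'} {B} {B'} {f} {g} = begin
    (μ _ ∘ T₁ (τ A' B') ∘ σ (T₀ A') B') ∘ (T₁ f ⁂ T₁ g)  ≈⟨ assoc² ⟩
    μ _ ∘ T₁ (τ A' B') ∘ σ (T₀ A') B' ∘ (T₁ f ⁂ T₁ g)    ≈⟨ refl⟩∘⟨ refl⟩∘⟨ σ-natural (T₁ f) g ⟩
    μ _ ∘ T₁ (τ A' B') ∘ T₁ (T₁ f ⁂ g) ∘ σ (T₀ A) B      ≈⟨ refl⟩∘⟨ extendʳ (T₁-square τ-natural) ⟩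
    μ _ ∘ T₁ (T₁ (f ⁂ g)) ∘ T₁ (τ A B) ∘ σ (T₀ A) B      ≈⟨ extendʳ (μ-natural (f ⁂ g)) ⟩
    T₁ (f ⁂ g) ∘ μ _ ∘ T₁ (τ A B) ∘ σ (T₀ A) B           ∎

  σ∘⁂η : ∀ {A A' B} {f : Hom A A'} → σ A' B ∘ (f ⁂ η B) ≈ η (A' ×₀ B) ∘ (f ⁂ id)
  σ∘⁂η {A} {A'} {B} {f} = begin
    σ A' B ∘ (f ⁂ η B)                 ≈⟨ refl⟩∘⟨ sym (trans ⁂∘⁂ (⁂-cong identityʳ T-id∘η)) ⟩
    σ A' B ∘ (f ⁂ T₁ id) ∘ (id ⁂ η B)  ≈⟨ extendʳ (σ-natural f id) ⟩
    T₁ (f ⁂ id) ∘ σ A B ∘ (id ⁂ η B)   ≈⟨ refl⟩∘⟨ σ-η ⟩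
    T₁ (f ⁂ id) ∘ η (A ×₀ B)           ≈⟨ sym (η-natural (f ⁂ id)) ⟩
    η (A' ×₀ B) ∘ (f ⁂ id)             ∎
    where
    T-id∘η : T₁ id ∘ η B ≈ η B
    T-id∘η = trans (T-identity ⟩∘⟨refl) identityˡ

  τ∘η⁂id : ∀ {A B} → τ A B ∘ (η A ⁂ id) ≈ η (A ×₀ B)
  τ∘η⁂id {A} {B} = begin
    (T₁ swap ∘ σ B A ∘ swap) ∘ (η A ⁂ id)  ≈⟨ assoc² ⟩
    T₁ swap ∘ σ B A ∘ swap ∘ (η A ⁂ id)    ≈⟨ refl⟩∘⟨ refl⟩∘⟨ swap∘⁂ ⟩
    T₁ swap ∘ σ B A ∘ (id ⁂ η A) ∘ swap    ≈⟨ refl⟩∘⟨ pullˡ σ-η ⟩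
    T₁ swap ∘ η (B ×₀ A) ∘ swap            ≈⟨ pullˡ (sym (η-natural swap)) ⟩
    (η (A ×₀ B) ∘ swap) ∘ swap             ≈⟨ pullʳ swap∘swap ⟩
    η (A ×₀ B) ∘ id                        ≈⟨ identityʳ ⟩
    η (A ×₀ B)                             ∎

  ∇∘η⁂η : ∀ {A B} → ∇ A B ∘ (η A ⁂ η B) ≈ η (A ×₀ B)
  ∇∘η⁂η {A} {B} = begin
    (μ _ ∘ T₁ (τ A B) ∘ σ (T₀ A) B) ∘ (η A ⁂ η B)  ≈⟨ assoc² ⟩
    μ _ ∘ T₁ (τ A B) ∘ σ (T₀ A) B ∘ (η A ⁂ η B)    ≈⟨ refl⟩∘⟨ refl⟩∘⟨ σ∘⁂η ⟩
    μ _ ∘ T₁ (τ A B) ∘ η (T₀ A ×₀ B) ∘ (η A ⁂ id)  ≈⟨ kleisli-pure ⟩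
    τ A B ∘ (η A ⁂ id)                             ≈⟨ τ∘η⁂id ⟩
    η (A ×₀ B)                                     ∎

module Sampling {o ℓ e : Level} (C : Category o ℓ e) (P : Cartesian C) (M : CommutativeMonad C P) where
  open Category C
  open HomReasoning C
  open Cartesian P
  open ProductProperties C P
  open CommutativeMonad M
  open Monad monad
  open MonadProperties C monad
  open CommutativeMonadProperties C P M
  open Theory C P M

  pow₁ : ∀ {A B} → Hom A B → ∀ n → Hom (pow A n) (pow B n)
  pow₁ f zero = id
  pow₁ f (suc zero) = f
  pow₁ f (suc (suc n)) = f ⁂ pow₁ f (suc n)

  diagonal : ∀ {A} n → Hom A (pow A n)
  diagonal zero = !
  diagonal (suc zero) = id
  diagonal (suc (suc n)) = ⟨ id , diagonal (suc n) ⟩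

  diagonal-natural : ∀ {A B} (f : Hom A B) n → diagonal n ∘ f ≈ pow₁ f n ∘ diagonal n
  diagonal-natural f zero = trans (!-unique _) (sym (trans identityˡ (!-unique _)))
  diagonal-natural f (suc zero) = id-comm-sym
  diagonal-natural f (suc (suc n)) = begin
    ⟨ id , diagonal (suc n) ⟩ ∘ f                    ≈⟨ ⟨⟩∘ ⟩
    ⟨ id ∘ f , diagonal (suc n) ∘ f ⟩                ≈⟨ ⟨⟩-cong (id-comm-sym)
                                                                (diagonal-natural f (suc n)) ⟩
    ⟨ f ∘ id , pow₁ f (suc n) ∘ diagonal (suc n) ⟩   ≈⟨ sym ⁂∘⟨⟩ ⟩
    (f ⁂ pow₁ f (suc n)) ∘ ⟨ id , diagonal (suc n) ⟩ ∎

  tensorN-cong : ∀ {A B} n {h h' : Fin n → A ⇝ B} → (∀ i → h i ≈ h' i) → tensorN n h ≈ tensorN n h'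
  tensorN-cong zero h≈h' = refl
  tensorN-cong (suc zero) h≈h' = h≈h' zero
  tensorN-cong (suc (suc n)) h≈h' =
    refl⟩∘⟨ ⁂-cong (h≈h' zero) (tensorN-cong (suc n) (λ i → h≈h' (suc i)))

  tensorN-∘-pow₁ : ∀ {A B D} n (k : Fin n → B ⇝ D) (f : Hom A B) →
                   tensorN n (λ i → k i ∘ f) ≈ tensorN n k ∘ pow₁ f n
  tensorN-∘-pow₁ zero k f = sym identityʳ
  tensorN-∘-pow₁ (suc zero) k f = refl
  tensorN-∘-pow₁ (suc (suc n)) k f =
    trans (refl⟩∘⟨ trans (⁂-cong refl (tensorN-∘-pow₁ (suc n) (λ i → k (suc i)) f)) (sym ⁂∘⁂))
          sym-assoc

  forceⁿ : ∀ A n → pow (T₀ A) n ⇝ pow A n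
  forceⁿ A n = tensorN n (λ _ → force A)

  forceⁿ-natural : ∀ {A B} (f : Hom A B) n → forceⁿ B n ∘ pow₁ (T₁ f) n ≈ T₁ (pow₁ f n) ∘ forceⁿ A n
  forceⁿ-natural f zero = trans identityʳ (sym (trans (T-identity ⟩∘⟨refl) identityˡ))
  forceⁿ-natural f (suc zero) = id-comm-sym
  forceⁿ-natural {A} {B} f (suc (suc n)) = begin
    (∇ _ _ ∘ (id ⁂ forceⁿ B (suc n))) ∘ (T₁ f ⁂ pow₁ (T₁ f) (suc n))
      ≈⟨ pullʳ ⁂∘⁂ ⟩
    ∇ _ _ ∘ ((id ∘ T₁ f) ⁂ (forceⁿ B (suc n) ∘ pow₁ (T₁ f) (suc n)))
      ≈⟨ refl⟩∘⟨ ⁂-cong id-comm-sym (forceⁿ-natural f (suc n)) ⟩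
    ∇ _ _ ∘ ((T₁ f ∘ id) ⁂ (T₁ (pow₁ f (suc n)) ∘ forceⁿ A (suc n)))
      ≈⟨ refl⟩∘⟨ sym ⁂∘⁂ ⟩
    ∇ _ _ ∘ (T₁ f ⁂ T₁ (pow₁ f (suc n))) ∘ (id ⁂ forceⁿ A (suc n))
      ≈⟨ extendʳ ∇-natural ⟩
    T₁ (f ⁂ pow₁ f (suc n)) ∘ ∇ _ _ ∘ (id ⁂ forceⁿ A (suc n))
      ∎

  copyN≈η∘diagonal : ∀ X n → copyN X n ≈ η (pow X n) ∘ diagonal n
  copyN≈η∘diagonal X zero = refl
  copyN≈η∘diagonal X (suc zero) = sym identityʳ
  copyN≈η∘diagonal X (suc (suc n)) = begin
    μ _ ∘ T₁ (∇ _ _ ∘ (η X ⁂ copyN X (suc n))) ∘ η _ ∘ Δ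
      ≈⟨ kleisli-pure ⟩
    (∇ _ _ ∘ (η X ⁂ copyN X (suc n))) ∘ Δ
      ≈⟨ (refl⟩∘⟨ ⁂-cong (sym identityʳ) (copyN≈η∘diagonal X (suc n))) ⟩∘⟨refl ⟩
    (∇ _ _ ∘ ((η X ∘ id) ⁂ (η _ ∘ diagonal (suc n)))) ∘ Δ
      ≈⟨ (refl⟩∘⟨ sym ⁂∘⁂) ⟩∘⟨refl ⟩
    (∇ _ _ ∘ (η X ⁂ η _) ∘ (id ⁂ diagonal (suc n))) ∘ Δ
      ≈⟨ pullˡ ∇∘η⁂η ⟩∘⟨refl ⟩
    (η _ ∘ (id ⁂ diagonal (suc n))) ∘ Δ
      ≈⟨ pullʳ (trans ⁂∘⟨⟩ (⟨⟩-cong identityˡ identityʳ)) ⟩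
    η _ ∘ ⟨ id , diagonal (suc n) ⟩
      ∎

  samp≈forceⁿ∘diagonal : ∀ X n → samp X n ≈ forceⁿ X n ∘ diagonal n
  samp≈forceⁿ∘diagonal X n = trans (refl⟩∘⟨ refl⟩∘⟨ copyN≈η∘diagonal (T₀ X) n) kleisli-pure

  samp-natural : ∀ {A B} (f : Hom A B) n → samp B n ∘ T₁ f ≈ T₁ (pow₁ f n) ∘ samp A n
  samp-natural {A} {B} f n = begin
    samp B n ∘ T₁ f                            ≈⟨ samp≈forceⁿ∘diagonal B n ⟩∘⟨refl ⟩
    (forceⁿ B n ∘ diagonal n) ∘ T₁ f           ≈⟨ pullʳ (diagonal-natural (T₁ f) n) ⟩
    forceⁿ B n ∘ pow₁ (T₁ f) n ∘ diagonal n    ≈⟨ pullˡ (forceⁿ-natural f n) ⟩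
    (T₁ (pow₁ f n) ∘ forceⁿ A n) ∘ diagonal n  ≈⟨ pullʳ (sym (samp≈forceⁿ∘diagonal A n)) ⟩
    T₁ (pow₁ f n) ∘ samp A n                   ∎

  observation : ∀ {A R} n → (Fin n → Hom A (T₀ R)) → T₀ A ⇝ pow R n
  observation {A} n h = tensorN n h ⊚ samp A n

  observation-natural : ∀ {A B R} n {h : Fin n → Hom A (T₀ R)} {k : Fin n → Hom B (T₀ R)} {f : Hom A B} →
                        (∀ i → k i ∘ f ≈ h i) → observation n h ≈ observation n k ∘ T₁ f
  observation-natural {A} {B} n {h} {k} {f} k∘f≈h = begin
    μ _ ∘ T₁ (tensorN n h) ∘ samp A n                  ≈⟨ refl⟩∘⟨ T-resp-≈ h≈k∘pow₁f ⟩∘⟨refl ⟩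
    μ _ ∘ T₁ (tensorN n k ∘ pow₁ f n) ∘ samp A n       ≈⟨ refl⟩∘⟨ T-homomorphism ⟩∘⟨refl ⟩
    μ _ ∘ (T₁ (tensorN n k) ∘ T₁ (pow₁ f n)) ∘ samp A n ≈⟨ refl⟩∘⟨ pullʳ (sym (samp-natural f n)) ⟩
    μ _ ∘ T₁ (tensorN n k) ∘ samp B n ∘ T₁ f           ≈⟨ sym assoc² ⟩
    (μ _ ∘ T₁ (tensorN n k) ∘ samp B n) ∘ T₁ f         ∎
    where
    h≈k∘pow₁f : tensorN n h ≈ tensorN n k ∘ pow₁ f n
    h≈k∘pow₁f = trans (tensorN-cong n (λ i → sym (k∘f≈h i))) (tensorN-∘-pow₁ n k f)

  observations-separate : ∀ {R X Y} {x y : Hom Y (T₀ X)} → Observational R →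
                          (∀ n (h : Fin n → Hom X (T₀ R)) → observation n h ∘ x ≈ observation n h ∘ y) →
                          x ≈ y
  observations-separate {X = X} {x = x} {y} observational same = begin
    x                  ≈⟨ sym (cancelˡ μ-identityʳ) ⟩
    μ X ∘ η _ ∘ x      ≈⟨ refl⟩∘⟨ ηx≈ηy ⟩
    μ X ∘ η _ ∘ y      ≈⟨ cancelˡ μ-identityʳ ⟩
    y                  ∎
    where
    ηx≈ηy : η (T₀ X) ∘ x ≈ η (T₀ X) ∘ y
    ηx≈ηy = observational X (η _ ∘ x) (η _ ∘ y)
              (λ n h → trans kleisli-pure (trans (same n h) (sym kleisli-pure)))

  T₁-cancel-regular-mono : ∀ {R A B Y} {i : Hom A B} {x y : Hom Y (T₀ A)} →
                           Observational R → InjectiveRegular C (T₀ R) → IsRegularMono C i →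
                           T₁ i ∘ x ≈ T₁ i ∘ y → x ≈ y
  T₁-cancel-regular-mono {R} {A} {B} {i = i} {x} {y} observational injective i-regular Ti∘x≈Ti∘y =
    observations-separate observational same
    where
    same : ∀ n (h : Fin n → Hom A (T₀ R)) → observation n h ∘ x ≈ observation n h ∘ y
    same n h = begin
      observation n h ∘ x           ≈⟨ h-extends ⟩∘⟨refl ⟩
      (observation n k ∘ T₁ i) ∘ x  ≈⟨ pullʳ Ti∘x≈Ti∘y ⟩
      observation n k ∘ T₁ i ∘ y    ≈⟨ sym-assoc ⟩
      (observation n k ∘ T₁ i) ∘ y  ≈⟨ sym h-extends ⟩∘⟨refl ⟩
      observation n h ∘ y           ∎
      where
      k : Fin n → Hom B (T₀ R)
      k j = proj₁ (injective i i-regular (h j))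
      h-extends : observation n h ≈ observation n k ∘ T₁ i
      h-extends = observation-natural n (λ j → proj₂ (injective i i-regular (h j)))

module ThunkableMonad {o ℓ e : Level} (C : Category o ℓ e) (P : Cartesian C) (M : CommutativeMonad C P)
                      (E : Theory.ThunkEqualizers C P M) where
  open Category C
  open HomReasoning C
  open CommutativeMonad M
  open Monad monad
  open MonadProperties C monad
  open Theory.ThunkEqualizers E
  module θ-Equalizer X = IsEqualizer (θ-equalizer X)

  θ-thunkable : ∀ X → Thunkable (θ X)
  θ-thunkable X = θ-Equalizer.equality X

  unit : ∀ X → Hom X (D₀ X)
  unit X = θ-Equalizer.factor X (η X) (η-natural (η X))

  θ∘unit : ∀ X → θ X ∘ unit X ≈ η X
  θ∘unit X = θ-Equalizer.factor-prop X _ _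

  join : ∀ X → Hom (D₀ (D₀ X)) (D₀ X)
  join X = θ-Equalizer.factor X (μ X ∘ T₁ (θ X) ∘ θ (D₀ X))
                                (thunkable-kleisli (θ-thunkable X) (θ-thunkable (D₀ X)))

  θ∘join : ∀ X → θ X ∘ join X ≈ μ X ∘ T₁ (θ X) ∘ θ (D₀ X)
  θ∘join X = θ-Equalizer.factor-prop X _ _

  join∘unit : ∀ X → join X ∘ unit (D₀ X) ≈ id
  join∘unit X = equalizer-monic (θ-equalizer X) (begin
    θ X ∘ join X ∘ unit (D₀ X)                 ≈⟨ pullˡ (θ∘join X) ⟩
    (μ X ∘ T₁ (θ X) ∘ θ (D₀ X)) ∘ unit (D₀ X)  ≈⟨ trans assoc² (refl⟩∘⟨ refl⟩∘⟨ θ∘unit (D₀ X)) ⟩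
    μ X ∘ T₁ (θ X) ∘ η (D₀ X)                  ≈⟨ kleisli-identityʳ ⟩
    θ X                                        ≈⟨ sym identityʳ ⟩
    θ X ∘ id                                   ∎)

  Tθ∘θ≈Tθ∘η∘join : ∀ X → T₁ (θ X) ∘ θ (D₀ X) ≈ T₁ (θ X) ∘ η (D₀ X) ∘ join X
  Tθ∘θ≈Tθ∘η∘join X = begin
    T₁ (θ X) ∘ θ (D₀ X)                   ≈⟨ sym (η∘kleisli (θ-thunkable (D₀ X))) ⟩
    η (T₀ X) ∘ μ X ∘ T₁ (θ X) ∘ θ (D₀ X)  ≈⟨ refl⟩∘⟨ sym (θ∘join X) ⟩
    η (T₀ X) ∘ θ X ∘ join X               ≈⟨ extendʳ (η-natural (θ X)) ⟩
    T₁ (θ X) ∘ η (D₀ X) ∘ join X          ∎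

  unit∘join : ∀ X → θ (D₀ X) ≈ η (D₀ X) ∘ join X → unit (D₀ X) ∘ join X ≈ id
  unit∘join X θ≈η∘join = equalizer-monic (θ-equalizer (D₀ X)) (begin
    θ (D₀ X) ∘ unit (D₀ X) ∘ join X  ≈⟨ pullˡ (θ∘unit (D₀ X)) ⟩
    η (D₀ X) ∘ join X                ≈⟨ sym θ≈η∘join ⟩
    θ (D₀ X)                         ≈⟨ sym identityʳ ⟩
    θ (D₀ X) ∘ id                    ∎)

proposition6p5 : ∀ {o ℓ e} (C : Category o ℓ e) (P : Cartesian C) (M : CommutativeMonad C P)
                 (E : Theory.ThunkEqualizers C P M) (R : Category.Obj C) →
                 Theory.Observational C P M R →
                 InjectiveRegular C (Monad.T₀ (CommutativeMonad.monad M) R) →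
                 Theory.DIdempotent C P M E
proposition6p5 C P M E R observational injective X =
  join X , θ∘join X , unit (D₀ X) , unit∘join X θ≈η∘join , join∘unit X
  where
  open Category C
  open Monad (CommutativeMonad.monad M)
  open Theory.ThunkEqualizers E
  open Sampling C P M
  open ThunkableMonad C P M E

  θ≈η∘join : θ (D₀ X) ≈ η (D₀ X) ∘ join X
  θ≈η∘join = T₁-cancel-regular-mono observational injective (equalizer-regular (θ-equalizer X))
                                    (Tθ∘θ≈Tθ∘η∘join X)
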